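{- Let $G(x)=\sum_{n\ge 0}G_n x^n$ and $\widehat F(x)=\sum_{n\ge0}\widehat F_n x^n$ be formal power series with complex coefficients, with $G_0=1$ and $\widehat F_0\neq 0$, and put $F(x)=x\,\widehat F(x)$. Define $R(n,m)$ by $\sum_{n\ge0}R(n,m)\,x^n=G(x)\,F(x)^m$ for $m\ge0$. For $d,m\ge0$ let $\widetilde D(d,m)=(d+m)!\,R(d+m,m)$, let $$E\widetilde D(d,t)=\sum_{m\ge0}\widetilde D(d,m)\,\frac{t^m}{m!},\qquad EE\widetilde DR(y,t)=\sum_{d\ge0}E\widetilde D(d,t)\,\frac{y^{d+1}}{(d+1)!}.$$ Let $x(t;y)\in\mathbb C[[t,y]]$ be the unique formal power series with zero constant term satisfying $x(t;y)-t\,F(x(t;y))=y$, and let $H(x)=\int G(x)\,dx$ be an antiderivative of $G$. Then $$EE\widetilde DR(y,t)=H(x(t;y))-H(0)=\sum_{n\ge0}G_n\,\frac{x(t;y)^{n+1}}{n+1}.$$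
   Context: All series are formal power series; no convergence questions are considered. -}

module Defs where

open import Algebra.Bundles using (CommutativeRing)
open import Data.Nat.Base using (ℕ; zero; suc; _∸_; _!) renaming (_+_ to _+ℕ_)

-- Formal power series over a commutative ring R.
--   univariate series  : ℕ → Carrier          (n ↦ coefficient of x^n)
--   bivariate series   : ℕ → ℕ → Carrier      (a b ↦ coefficient of t^a y^b)
module Series {c ℓ} (R : CommutativeRing c ℓ) where
  open CommutativeRing R

  PS : Set c
  PS = ℕ → Carrier

  PS2 : Set c
  PS2 = ℕ → ℕ → Carrier

  sumTo : ℕ → (ℕ → Carrier) → Carrier
  sumTo zero    f = f 0
  sumTo (suc n) f = sumTo n f + f (suc n)

  natR : ℕ → Carrier
  natR zero    = 0#
  natR (suc n) = 1# + natR n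

  -- 1/n, given a function inv with (n+1) * inv n = 1; only used for n ≥ 1
  recip : (ℕ → Carrier) → ℕ → Carrier
  recip inv n = inv (n ∸ 1)

  one1 : PS
  one1 zero    = 1#
  one1 (suc n) = 0#

  mul1 : PS → PS → PS
  mul1 f g n = sumTo n (λ i → f i * g (n ∸ i))

  pow1 : PS → ℕ → PS
  pow1 f zero    = one1
  pow1 f (suc m) = mul1 f (pow1 f m)

  xMul : PS → PS
  xMul f zero    = 0#
  xMul f (suc n) = f n

  one2 : PS2
  one2 zero    zero    = 1#
  one2 zero    (suc b) = 0#
  one2 (suc a) b       = 0#

  const2 : Carrier → PS2
  const2 k zero    zero    = k
  const2 k zero    (suc b) = 0#
  const2 k (suc a) b       = 0#

  ySer : PS2
  ySer zero zero          = 0#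
  ySer zero (suc zero)    = 1#
  ySer zero (suc (suc b)) = 0#
  ySer (suc a) b          = 0#

  tMul : PS2 → PS2
  tMul P zero    b = 0#
  tMul P (suc a) b = P a b

  mul2 : PS2 → PS2 → PS2
  mul2 P Q a b = sumTo a (λ i → sumTo b (λ j → P i j * Q (a ∸ i) (b ∸ j)))

  pow2 : PS2 → ℕ → PS2
  pow2 P zero    = one2
  pow2 P (suc n) = mul2 P (pow2 P n)

  -- composition f(X) for X with zero constant term:
  -- only X^n with n ≤ a + b contribute to the coefficient of t^a y^b
  compose : PS → PS2 → PS2
  compose f X a b = sumTo (a +ℕ b) (λ n → f n * pow2 X n a b)

  Rnm : PS → PS → ℕ → ℕ → Carrier
  Rnm G F n m = mul1 G (pow1 F m) n

  Dtilde : PS → PS → ℕ → ℕ → Carrier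
  Dtilde G F d m = natR ((d +ℕ m) !) * Rnm G F (d +ℕ m) m

  EDtilde : (ℕ → Carrier) → PS → PS → ℕ → ℕ → Carrier
  EDtilde inv G F d m = Dtilde G F d m * recip inv (m !)

  -- EE D̃R(y,t) = Σ_d E D̃(d,t) y^(d+1)/(d+1)!   (coefficient of t^m y^k)
  EEDtildeR : (ℕ → Carrier) → PS → PS → PS2
  EEDtildeR inv G F m zero    = 0#
  EEDtildeR inv G F m (suc d) = EDtilde inv G F d m * recip inv (suc d !)

  intComp : (ℕ → Carrier) → PS → PS2 → PS2
  intComp inv G X a b = sumTo (a +ℕ b) (λ n → G n * inv n * pow2 X (suc n) a b)

module Submission where

-- Proof of Corollary 3 by the method of characteristics.
--
-- A bivariate series
-- P a b (coefficient of t^a y^b) is a power series in t whose coefficients are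
-- power series in y, so the ring T of bivariate series is obtained by applying
-- the construction "ring of power series" twice.  Let X = y + t F(X).
--
--  1. Differentiating gives X_t = F(X) + t F'(X) X_t and X_y = 1 + t F'(X) X_y.
--     Hence F(X) X_y solves the first equation as well, and since an equation
--     A = Z + t W A has at most one solution, X_t = F(X) X_y.
--  2. By the chain rule every U = A(X) then satisfies U_t = F(X) U_y, and this
--     "transport equation" is preserved by products.
--  3. For Φ = H(X) and Ψ = Φ_y induction gives ∂_t^(m+1) Φ = ∂_y^m (Ψ F(X)^(m+1)).
--  4. At t = 0 we have X = y, so Ψ = H'(y) = G(y); comparing coefficients of
--     t^0 y^b in 3 yields b! (m+1)! [t^(m+1) y^b] Φ = (b+m)! [y^(b+m)] G F^(m+1),
--     i.e. the coefficients of Φ are those of EE D̃R.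
--  5. The second formula is the term-by-term expansion of H(X) - H(0) using H' = G.

open import Defs
open import Algebra.Bundles using (CommutativeRing)
open import Data.Nat.Base
  using (ℕ; zero; suc; _∸_; _!; pred; _≤_; _<_; z≤n; s≤s)
  renaming (_+_ to _+ℕ_; _*_ to _*ℕ_)
import Data.Nat.Properties as ℕₚ
open import Data.Product using (_×_; _,_)
open import Function.Base using (_∘_)
open import Relation.Nullary using (¬_)
import Relation.Binary.PropositionalEquality as Eq
import Relation.Binary.Reasoning.Setoid as SetoidReasoning

module FiniteSums {c ℓ} (R : CommutativeRing c ℓ) where
  open CommutativeRing R
  open Series R using (sumTo; natR)
  open SetoidReasoning setoid
  open import Algebra.Solver.Ring.NaturalCoefficients.Default commutativeSemiring
    using (solve; _:+_; _:=_)
  open import Algebra.Properties.Semiring.Mult semiring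
    using (×-homo-+; ×1-homo-*) renaming (_×_ to _·_)

  Σ-cong : ∀ n {f g : ℕ → Carrier} → (∀ i → f i ≈ g i) → sumTo n f ≈ sumTo n g
  Σ-cong zero    e = e 0
  Σ-cong (suc n) e = +-cong (Σ-cong n e) (e (suc n))

  Σ-cong≤ : ∀ n {f g : ℕ → Carrier} → (∀ i → i ≤ n → f i ≈ g i) → sumTo n f ≈ sumTo n g
  Σ-cong≤ zero    e = e 0 z≤n
  Σ-cong≤ (suc n) e = +-cong (Σ-cong≤ n (λ i i≤n → e i (ℕₚ.m≤n⇒m≤1+n i≤n))) (e (suc n) ℕₚ.≤-refl)

  Σ-zero : ∀ n {f : ℕ → Carrier} → (∀ i → i ≤ n → f i ≈ 0#) → sumTo n f ≈ 0#
  Σ-zero n e = trans (Σ-cong≤ n e) (zero-sum n)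
    where
    zero-sum : ∀ n → sumTo n (λ _ → 0#) ≈ 0#
    zero-sum zero    = refl
    zero-sum (suc n) = trans (+-congʳ (zero-sum n)) (+-identityˡ 0#)

  Σ-+ : ∀ n (f g : ℕ → Carrier) → sumTo n (λ i → f i + g i) ≈ sumTo n f + sumTo n g
  Σ-+ zero    f g = refl
  Σ-+ (suc n) f g = trans (+-congʳ (Σ-+ n f g)) (interchange _ _ _ _)
    where
    interchange : ∀ a b x y → (a + b) + (x + y) ≈ (a + x) + (b + y)
    interchange = solve 4 (λ a b x y → ((a :+ b) :+ (x :+ y)) := ((a :+ x) :+ (b :+ y))) refl

  Σ-*ˡ : ∀ n k (f : ℕ → Carrier) → k * sumTo n f ≈ sumTo n (λ i → k * f i)
  Σ-*ˡ zero    k f = refl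
  Σ-*ˡ (suc n) k f = trans (distribˡ k _ _) (+-congʳ (Σ-*ˡ n k f))

  Σ-*ʳ : ∀ n k (f : ℕ → Carrier) → sumTo n f * k ≈ sumTo n (λ i → f i * k)
  Σ-*ʳ zero    k f = refl
  Σ-*ʳ (suc n) k f = trans (distribʳ k _ _) (+-congʳ (Σ-*ʳ n k f))

  Σ-shift : ∀ n (f : ℕ → Carrier) → sumTo (suc n) f ≈ f 0 + sumTo n (f ∘ suc)
  Σ-shift zero    f = refl
  Σ-shift (suc n) f = trans (+-congʳ (Σ-shift n f)) (+-assoc _ _ _)

  Σ-head : ∀ n (f : ℕ → Carrier) → (∀ i → f (suc i) ≈ 0#) → sumTo n f ≈ f 0
  Σ-head zero    f e = refl
  Σ-head (suc n) f e = trans (+-cong (Σ-head n f e) (e n)) (+-identityʳ _)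

  Σ-extend : ∀ m N (f : ℕ → Carrier) → m ≤ N → (∀ i → m < i → f i ≈ 0#) → sumTo N f ≈ sumTo m f
  Σ-extend m N f m≤N e =
    trans (reflexive (Eq.cong (λ z → sumTo z f) (Eq.sym (ℕₚ.m+[n∸m]≡n m≤N)))) (by-steps (N ∸ m))
    where
    by-steps : ∀ k → sumTo (m +ℕ k) f ≈ sumTo m f
    by-steps zero    = reflexive (Eq.cong (λ z → sumTo z f) (ℕₚ.+-identityʳ m))
    by-steps (suc k) = trans (reflexive (Eq.cong (λ z → sumTo z f) (ℕₚ.+-suc m k)))
      (trans (+-cong (by-steps k) (e (suc (m +ℕ k)) (s≤s (ℕₚ.m≤m+n m k)))) (+-identityʳ _))

  Σ-reverse : ∀ n (f : ℕ → Carrier) → sumTo n f ≈ sumTo n (λ i → f (n ∸ i))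
  Σ-reverse zero    f = refl
  Σ-reverse (suc n) f = begin
      sumTo n f + f (suc n)                       ≈⟨ +-comm _ _ ⟩
      f (suc n) + sumTo n f                       ≈⟨ +-congˡ (Σ-reverse n f) ⟩
      f (suc n) + sumTo n (λ i → f (n ∸ i))       ≈⟨ Σ-shift n (λ i → f (suc n ∸ i)) ⟨
      sumTo (suc n) (λ i → f (suc n ∸ i))         ∎

  Σ-triangle : ∀ n (F : ℕ → ℕ → Carrier) →
    sumTo n (λ i → sumTo (n ∸ i) (F i)) ≈ sumTo n (λ k → sumTo k (λ i → F i (k ∸ i)))
  Σ-triangle zero    F = refl
  Σ-triangle (suc n) F = begin
      sumTo (suc n) (λ i → sumTo (suc n ∸ i) (F i))
    ≈⟨ Σ-shift n _ ⟩
      sumTo (suc n) (F 0) + sumTo n (λ i → sumTo (n ∸ i) (F (suc i)))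
    ≈⟨ +-cong (Σ-shift n _) (Σ-triangle n (F ∘ suc)) ⟩
      (F 0 0 + sumTo n (F 0 ∘ suc)) + sumTo n (λ k → sumTo k (λ i → F (suc i) (k ∸ i)))
    ≈⟨ +-assoc _ _ _ ⟩
      F 0 0 + (sumTo n (F 0 ∘ suc) + sumTo n (λ k → sumTo k (λ i → F (suc i) (k ∸ i))))
    ≈⟨ +-congˡ (Σ-+ n _ _) ⟨
      F 0 0 + sumTo n (λ k → F 0 (suc k) + sumTo k (λ i → F (suc i) (k ∸ i)))
    ≈⟨ +-congˡ (Σ-cong n (λ k → Σ-shift k (λ i → F i (suc k ∸ i)))) ⟨
      F 0 0 + sumTo n (λ k → sumTo (suc k) (λ i → F i (suc k ∸ i)))
    ≈⟨ Σ-shift n _ ⟨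
      sumTo (suc n) (λ k → sumTo k (λ i → F i (k ∸ i))) ∎

  -- natR is the library's n × 1#, so it is a semiring homomorphism ℕ → R
  natR≈·1 : ∀ n → natR n ≈ n · 1#
  natR≈·1 zero    = refl
  natR≈·1 (suc n) = +-congˡ (natR≈·1 n)

  natR-+ : ∀ m n → natR (m +ℕ n) ≈ natR m + natR n
  natR-+ m n = trans (natR≈·1 (m +ℕ n))
    (trans (×-homo-+ 1# m n) (sym (+-cong (natR≈·1 m) (natR≈·1 n))))

  natR-* : ∀ m n → natR (m *ℕ n) ≈ natR m * natR n
  natR-* m n = trans (natR≈·1 (m *ℕ n))
    (trans (×1-homo-* m n) (sym (*-cong (natR≈·1 m) (natR≈·1 n))))

module PowerSeries {c ℓ} (R : CommutativeRing c ℓ) where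
  open CommutativeRing R
  open Series R
  open FiniteSums R
  open SetoidReasoning setoid
  open import Algebra.Solver.Ring.NaturalCoefficients.Default commutativeSemiring
    using (solve; _:+_; _:*_; _:=_)

  mul1-cong : ∀ {f f′ g g′ : PS} → (∀ i → f i ≈ f′ i) → (∀ i → g i ≈ g′ i) →
              ∀ n → mul1 f g n ≈ mul1 f′ g′ n
  mul1-cong ef eg n = Σ-cong n (λ i → *-cong (ef i) (eg (n ∸ i)))

  mul1-comm : ∀ (f g : PS) n → mul1 f g n ≈ mul1 g f n
  mul1-comm f g n = trans (Σ-reverse n _) (Σ-cong≤ n (λ i i≤n →
    trans (*-comm _ _) (*-congʳ (reflexive (Eq.cong g (ℕₚ.m∸[m∸n]≡n i≤n))))))

  mul1-assoc : ∀ (f g h : PS) n → mul1 (mul1 f g) h n ≈ mul1 f (mul1 g h) n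
  mul1-assoc f g h n = begin
      sumTo n (λ k → sumTo k (λ i → f i * g (k ∸ i)) * h (n ∸ k))
    ≈⟨ Σ-cong n (λ k → Σ-*ʳ k _ _) ⟩
      sumTo n (λ k → sumTo k (λ i → (f i * g (k ∸ i)) * h (n ∸ k)))
    ≈⟨ Σ-cong≤ n (λ k k≤n → Σ-cong≤ k (λ i i≤k → trans (*-assoc _ _ _)
         (*-congˡ (*-congˡ (reflexive (Eq.cong h (Eq.sym (∸-∸ i≤k k≤n)))))))) ⟩
      sumTo n (λ k → sumTo k (λ i → f i * (g (k ∸ i) * h ((n ∸ i) ∸ (k ∸ i)))))
    ≈⟨ Σ-triangle n (λ i j → f i * (g j * h ((n ∸ i) ∸ j))) ⟨
      sumTo n (λ i → sumTo (n ∸ i) (λ j → f i * (g j * h ((n ∸ i) ∸ j))))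
    ≈⟨ Σ-cong n (λ i → Σ-*ˡ (n ∸ i) _ _) ⟨
      mul1 f (mul1 g h) n ∎
    where
    ∸-∸ : ∀ {i k} → i ≤ k → k ≤ n → (n ∸ i) ∸ (k ∸ i) Eq.≡ n ∸ k
    ∸-∸ {i} {k} i≤k _ = Eq.trans (ℕₚ.∸-+-assoc n i (k ∸ i)) (Eq.cong (n ∸_) (ℕₚ.m+[n∸m]≡n i≤k))

  mul1-distribˡ : ∀ (f g h : PS) n → mul1 f (λ i → g i + h i) n ≈ mul1 f g n + mul1 f h n
  mul1-distribˡ f g h n = trans (Σ-cong n (λ i → distribˡ _ _ _)) (Σ-+ n _ _)

  mul1-constˡ : ∀ (k f : PS) → (∀ j → k (suc j) ≈ 0#) → ∀ n → mul1 k f n ≈ k 0 * f n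
  mul1-constˡ k f e n = Σ-head n _ (λ i → trans (*-congʳ (e i)) (zeroˡ _))

  mul1-oneˡ : ∀ (f : PS) n → mul1 one1 f n ≈ f n
  mul1-oneˡ f n = trans (mul1-constˡ one1 f (λ _ → refl) n) (*-identityˡ _)

  PSRing : CommutativeRing c ℓ
  PSRing = record
    { Carrier = PS
    ; _≈_ = λ f g → ∀ n → f n ≈ g n
    ; _+_ = λ f g n → f n + g n
    ; _*_ = mul1
    ; -_ = λ f n → - f n
    ; 0# = λ _ → 0#
    ; 1# = one1
    ; isCommutativeRing = record
      { isRing = record
        { +-isAbelianGroup = Pointwise.isAbelianGroup +-isAbelianGroup
        ; *-cong = mul1-cong
        ; *-assoc = mul1-assoc
        ; *-identity = mul1-oneˡ , λ f n → trans (mul1-comm f one1 n) (mul1-oneˡ f n)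
        ; distrib = mul1-distribˡ , λ f g h n → trans (mul1-comm _ f n)
            (trans (mul1-distribˡ f g h n) (+-cong (mul1-comm f g n) (mul1-comm f h n)))
        }
      ; *-comm = mul1-comm
      }
    }
    where import Algebra.Construct.Pointwise ℕ as Pointwise

  sumTo-coeff : ∀ n (F : ℕ → PS) b → Series.sumTo PSRing n F b Eq.≡ sumTo n (λ i → F i b)
  sumTo-coeff zero    F b = Eq.refl
  sumTo-coeff (suc n) F b = Eq.cong (_+ F (suc n) b) (sumTo-coeff n F b)

  deriv : PS → PS
  deriv f n = natR (suc n) * f (suc n)

  -- Leibniz rule (f g)′ = f′ g + f g′, read at the coefficient of x^n
  leibniz : ∀ (f g : PS) n → natR (suc n) * mul1 f g (suc n) ≈ mul1 (deriv f) g n + mul1 f (deriv g) n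
  leibniz f g n = begin
      natR (suc n) * mul1 f g (suc n)
    ≈⟨ Σ-*ˡ (suc n) _ _ ⟩
      sumTo (suc n) (λ i → natR (suc n) * (f i * g (suc n ∸ i)))
    ≈⟨ Σ-cong≤ (suc n) split-degree ⟩
      sumTo (suc n) (λ i → natR i * f i * g (suc n ∸ i) + f i * (natR (suc n ∸ i) * g (suc n ∸ i)))
    ≈⟨ Σ-+ (suc n) _ _ ⟩
      sumTo (suc n) (λ i → natR i * f i * g (suc n ∸ i)) + sumTo (suc n) (λ i → f i * (natR (suc n ∸ i) * g (suc n ∸ i)))
    ≈⟨ +-cong first-term-vanishes last-term-vanishes ⟩
      mul1 (deriv f) g n + mul1 f (deriv g) n ∎
    where
    -- the degree n+1 of each term splits as i + (n+1-i)
    split-degree : ∀ i → i ≤ suc n →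
      natR (suc n) * (f i * g (suc n ∸ i)) ≈ natR i * f i * g (suc n ∸ i) + f i * (natR (suc n ∸ i) * g (suc n ∸ i))
    split-degree i i≤ = trans (*-congʳ (trans (reflexive (Eq.cong natR (Eq.sym (ℕₚ.m+[n∸m]≡n i≤)))) (natR-+ i _)))
      (distribute (natR i) (natR (suc n ∸ i)) (f i) (g (suc n ∸ i)))
      where
      distribute : ∀ a b x y → (a + b) * (x * y) ≈ a * x * y + x * (b * y)
      distribute = solve 4 (λ a b x y → ((a :+ b) :* (x :* y)) := (((a :* x) :* y) :+ (x :* (b :* y)))) refl
    first-term-vanishes : sumTo (suc n) (λ i → natR i * f i * g (suc n ∸ i)) ≈ mul1 (deriv f) g n
    first-term-vanishes = trans (Σ-shift n _) (trans (+-congʳ (trans (*-congʳ (zeroˡ _)) (zeroˡ _))) (+-identityˡ _))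
    last-term-vanishes : sumTo (suc n) (λ i → f i * (natR (suc n ∸ i) * g (suc n ∸ i))) ≈ mul1 f (deriv g) n
    last-term-vanishes = trans (+-cong
        (Σ-cong≤ n (λ i i≤n → reflexive (Eq.cong (λ z → f i * (natR z * g z)) (ℕₚ.+-∸-assoc 1 i≤n))))
        (trans (*-congˡ (trans (*-congʳ (reflexive (Eq.cong natR (ℕₚ.n∸n≡0 n)))) (zeroˡ _))) (zeroʳ _)))
      (+-identityʳ _)

  pow1-cong : ∀ {f g : PS} → (∀ i → f i ≈ g i) → ∀ m n → pow1 f m n ≈ pow1 g m n
  pow1-cong e zero    n = refl
  pow1-cong e (suc m) n = mul1-cong e (pow1-cong e m) n

  xMul-mul1 : ∀ (f g : PS) n → mul1 (xMul f) g n ≈ xMul (mul1 f g) n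
  xMul-mul1 f g zero    = zeroˡ _
  xMul-mul1 f g (suc n) = trans (Σ-shift n _) (trans (+-congʳ (zeroˡ _)) (+-identityˡ _))

  xMul-pow-low : ∀ (f : PS) m n → n < m → pow1 (xMul f) m n ≈ 0#
  xMul-pow-low f (suc m) zero    _         = zeroˡ _
  xMul-pow-low f (suc m) (suc n) (s≤s n<m) = trans (xMul-mul1 f (pow1 (xMul f) m) (suc n))
    (Σ-zero n (λ i _ → trans (*-congˡ (xMul-pow-low f m (n ∸ i) (ℕₚ.≤-<-trans (ℕₚ.m∸n≤m n i) n<m)))
                             (zeroʳ _)))

  xSer : PS
  xSer = xMul one1

  -- substituting x into A returns A:  Σ_{n ≤ b} A n [x^b] x^n = A b
  subst-x : ∀ b (A : PS) → sumTo b (λ n → A n * pow1 xSer n b) ≈ A b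
  subst-x zero    A = *-identityʳ _
  subst-x (suc b) A = trans (Σ-shift b _) (trans (+-cong (zeroʳ _)
      (trans (Σ-cong b (λ n → *-congˡ (lower n))) (subst-x b (A ∘ suc)))) (+-identityˡ _))
    where
    lower : ∀ n → pow1 xSer (suc n) (suc b) ≈ pow1 xSer n b
    lower n = trans (xMul-mul1 one1 (pow1 xSer n) (suc b)) (mul1-oneˡ (pow1 xSer n) b)

module Bivariate {c ℓ} (R : CommutativeRing c ℓ) where
  open CommutativeRing R
  open Series R
  open FiniteSums R
  open PowerSeries R
  open SetoidReasoning setoid

  module S = Series PSRing
  module Sₚ = PowerSeries PSRing

  T : CommutativeRing c ℓ
  T = Sₚ.PSRing
  module T = CommutativeRing T
  module TS = Series T
  module TΣ = FiniteSums T
  module TR = SetoidReasoning T.setoid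
  open import Algebra.Solver.Ring.NaturalCoefficients.Default T.commutativeSemiring
    using () renaming (solve to solveT; _:+_ to _⊕_; _:*_ to _⊗_; _:=_ to _⊜_; con to conT)

  _≈T_ : PS2 → PS2 → Set ℓ
  _≈T_ = T._≈_
  infix 4 _≈T_

  T*≡mul2 : ∀ (P Q : PS2) a b → (P T.* Q) a b Eq.≡ mul2 P Q a b
  T*≡mul2 P Q a b = sumTo-coeff a (λ i → mul1 (P i) (Q (a ∸ i))) b

  sumTo-coeff₂ : ∀ n (F : ℕ → PS2) a b → Series.sumTo T n F a b Eq.≡ sumTo n (λ i → F i a b)
  sumTo-coeff₂ n F a b =
    Eq.trans (Eq.cong (λ z → z b) (Sₚ.sumTo-coeff n F a)) (sumTo-coeff n (λ i → F i a) b)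

  mul-localˡ : ∀ (P P′ Q : PS2) a b → (∀ i j → i ≤ a → j ≤ b → P i j ≈ P′ i j) →
               (P T.* Q) a b ≈ (P′ T.* Q) a b
  mul-localˡ P P′ Q a b e = trans (reflexive (T*≡mul2 P Q a b)) (trans
     (Σ-cong≤ a (λ i i≤a → Σ-cong≤ b (λ j j≤b → *-congʳ (e i j i≤a j≤b))))
     (reflexive (Eq.sym (T*≡mul2 P′ Q a b))))

  mul-localʳ : ∀ (Q P P′ : PS2) a b → (∀ i j → i ≤ a → j ≤ b → P i j ≈ P′ i j) →
               (Q T.* P) a b ≈ (Q T.* P′) a b
  mul-localʳ Q P P′ a b e = trans (T.*-comm Q P a b) (trans (mul-localˡ P P′ Q a b e) (T.*-comm P′ Q a b))

  Dt Dy : PS2 → PS2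
  Dt P a b = natR (suc a) * P (suc a) b
  Dy P a b = natR (suc b) * P a (suc b)

  Dt-cong : ∀ {P Q} → P ≈T Q → Dt P ≈T Dt Q
  Dt-cong e a b = *-congˡ (e (suc a) b)
  Dy-cong : ∀ {P Q} → P ≈T Q → Dy P ≈T Dy Q
  Dy-cong e a b = *-congˡ (e a (suc b))

  Dt-+ : ∀ P Q → Dt (P T.+ Q) ≈T (Dt P T.+ Dt Q)
  Dt-+ P Q a b = distribˡ _ _ _
  Dy-+ : ∀ P Q → Dy (P T.+ Q) ≈T (Dy P T.+ Dy Q)
  Dy-+ P Q a b = distribˡ _ _ _

  Dt-Dy-comm : ∀ P → Dt (Dy P) ≈T Dy (Dt P)
  Dt-Dy-comm P a b = trans (sym (*-assoc _ _ _)) (trans (*-congʳ (*-comm _ _)) (*-assoc _ _ _))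

  -- ∂_t is the derivation of T as power series over S = R[[y]], whose
  -- integers natR k are the constants k
  Dt≈deriv : ∀ P → Dt P ≈T Sₚ.deriv P
  Dt≈deriv P a b = sym (trans (mul1-constˡ (S.natR (suc a)) (P (suc a)) (natS-suc (suc a)) b)
                              (*-congʳ (natS-0 (suc a))))
    where
    natS-0 : ∀ k → S.natR k 0 ≈ natR k
    natS-0 zero    = refl
    natS-0 (suc k) = +-congˡ (natS-0 k)
    natS-suc : ∀ k j → S.natR k (suc j) ≈ 0#
    natS-suc zero    j = refl
    natS-suc (suc k) j = trans (+-congˡ (natS-suc k j)) (+-identityʳ _)

  Dt-leibniz : ∀ P Q → Dt (P T.* Q) ≈T ((Dt P T.* Q) T.+ (P T.* Dt Q))
  Dt-leibniz P Q = TR.begin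
      Dt (P T.* Q)                                    TR.≈⟨ Dt≈deriv (P T.* Q) ⟩
      Sₚ.deriv (P T.* Q)                              TR.≈⟨ Sₚ.leibniz P Q ⟩
      (Sₚ.deriv P T.* Q) T.+ (P T.* Sₚ.deriv Q)       TR.≈⟨ T.+-cong (T.*-cong (T.sym (Dt≈deriv P)) (T.refl {Q}))
                                                                     (T.*-cong (T.refl {P}) (T.sym (Dt≈deriv Q))) ⟩
      (Dt P T.* Q) T.+ (P T.* Dt Q)                   TR.∎

  -- ∂_y is the derivation of R[[y]] applied coefficientwise in t
  Dy-leibniz : ∀ P Q → Dy (P T.* Q) ≈T ((Dy P T.* Q) T.+ (P T.* Dy Q))
  Dy-leibniz P Q a b = begin
      natR (suc b) * (P T.* Q) a (suc b)
    ≈⟨ *-congˡ (reflexive (T*≡mul2 P Q a (suc b))) ⟩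
      natR (suc b) * sumTo a (λ i → mul1 (P i) (Q (a ∸ i)) (suc b))
    ≈⟨ Σ-*ˡ a _ _ ⟩
      sumTo a (λ i → natR (suc b) * mul1 (P i) (Q (a ∸ i)) (suc b))
    ≈⟨ Σ-cong a (λ i → leibniz (P i) (Q (a ∸ i)) b) ⟩
      sumTo a (λ i → mul1 (deriv (P i)) (Q (a ∸ i)) b + mul1 (P i) (deriv (Q (a ∸ i))) b)
    ≈⟨ Σ-+ a _ _ ⟩
      sumTo a (λ i → mul1 (deriv (P i)) (Q (a ∸ i)) b) + sumTo a (λ i → mul1 (P i) (deriv (Q (a ∸ i))) b)
    ≈⟨ +-cong (reflexive (T*≡mul2 (Dy P) Q a b)) (reflexive (T*≡mul2 P (Dy Q) a b)) ⟨
      ((Dy P T.* Q) T.+ (P T.* Dy Q)) a b ∎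

  const-cong : ∀ {k l} → k ≈ l → const2 k ≈T const2 l
  const-cong e zero    zero    = e
  const-cong e zero    (suc b) = refl
  const-cong e (suc a) b       = refl

  const-mul : ∀ k (P : PS2) a b → (const2 k T.* P) a b ≈ k * P a b
  const-mul k P a b = trans (reflexive (T*≡mul2 (const2 k) P a b)) (trans
     (Σ-head a _ (λ i → Σ-zero b (λ j _ → zeroˡ _)))
     (Σ-head b _ (λ j → zeroˡ _)))

  const-1 : const2 1# ≈T T.1#
  const-1 zero    zero    = refl
  const-1 zero    (suc b) = refl
  const-1 (suc a) b       = refl

  const-+ : ∀ k l → const2 (k + l) ≈T (const2 k T.+ const2 l)
  const-+ k l zero    zero    = refl
  const-+ k l zero    (suc b) = sym (+-identityˡ _)
  const-+ k l (suc a) b       = sym (+-identityˡ _)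

  const-* : ∀ k l → (const2 k T.* const2 l) ≈T const2 (k * l)
  const-* k l a b = trans (const-mul k (const2 l) a b) (scale a b)
    where
    scale : ∀ a b → k * const2 l a b ≈ const2 (k * l) a b
    scale zero    zero    = refl
    scale zero    (suc b) = zeroʳ _
    scale (suc a) b       = zeroʳ _

  Dt-const : ∀ k → Dt (const2 k) ≈T T.0#
  Dt-const k a b = zeroʳ _
  Dy-const : ∀ k → Dy (const2 k) ≈T T.0#
  Dy-const k zero    b = zeroʳ _
  Dy-const k (suc a) b = zeroʳ _

  powT : PS2 → ℕ → PS2
  powT = S.pow1

  pow2≈powT : ∀ P n → pow2 P n ≈T powT P n
  pow2≈powT P zero    zero    zero    = refl
  pow2≈powT P zero    zero    (suc b) = refl
  pow2≈powT P zero    (suc a) b       = refl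
  pow2≈powT P (suc n) a b = trans (reflexive (Eq.sym (T*≡mul2 P (pow2 P n) a b)))
                                  (T.*-cong (T.refl {P}) (pow2≈powT P n) a b)

  powT-row0 : ∀ P n b → powT P n 0 b ≈ pow1 (P 0) n b
  powT-row0 P zero    b = refl
  powT-row0 P (suc n) b = mul1-cong (λ _ → refl) (powT-row0 P n) b

  tMul-cong : ∀ {P Q} → P ≈T Q → tMul P ≈T tMul Q
  tMul-cong e zero    b = refl
  tMul-cong e (suc a) b = e a b

  tMul-mulʳ : ∀ P Q → (P T.* tMul Q) ≈T tMul (P T.* Q)
  tMul-mulʳ P Q = T.trans (T.*-comm P (tMul Q)) (T.trans t-left (tMul-cong (T.*-comm Q P)))
    where
    tMul≈xMul : ∀ P → tMul P ≈T S.xMul P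
    tMul≈xMul P zero    b = refl
    tMul≈xMul P (suc a) b = refl
    t-left : (tMul Q T.* P) ≈T tMul (Q T.* P)
    t-left = T.trans (T.*-cong (tMul≈xMul Q) (T.refl {P}))
               (T.trans (Sₚ.xMul-mul1 Q P) (T.sym (tMul≈xMul (Q T.* P))))

  Dt-tMul : ∀ P → Dt (tMul P) ≈T (P T.+ tMul (Dt P))
  Dt-tMul P zero    b = trans (*-congʳ (+-identityʳ _)) (trans (*-identityˡ _) (sym (+-identityʳ _)))
  Dt-tMul P (suc a) b = trans (distribʳ _ _ _) (+-congʳ (*-identityˡ _))
  Dy-tMul : ∀ P → Dy (tMul P) ≈T tMul (Dy P)
  Dy-tMul P zero    b = zeroʳ _
  Dy-tMul P (suc a) b = refl

  Dt-y : Dt ySer ≈T T.0#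
  Dt-y a b = zeroʳ _
  Dy-y : Dy ySer ≈T T.1#
  Dy-y zero    zero    = trans (*-identityʳ _) (+-identityʳ _)
  Dy-y zero    (suc b) = zeroʳ _
  Dy-y (suc a) b       = zeroʳ _

  ySer-row0 : ∀ b → ySer 0 b ≈ xSer b
  ySer-row0 zero          = refl
  ySer-row0 (suc zero)    = refl
  ySer-row0 (suc (suc b)) = refl

  -- A = Z + t W A determines A: its t^a row is fixed by the rows below it
  fixpoint-unique : ∀ (Z W A B : PS2) →
    A ≈T (Z T.+ tMul (W T.* A)) → B ≈T (Z T.+ tMul (W T.* B)) → A ≈T B
  fixpoint-unique Z W A B eA eB a = rows-agree a a ℕₚ.≤-refl
    where
    rows-agree : ∀ a i → i ≤ a → ∀ b → A i b ≈ B i b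
    rows-agree a       zero    _         b = trans (eA 0 b) (sym (eB 0 b))
    rows-agree (suc a) (suc i) (s≤s i≤a) b = trans (eA (suc i) b) (trans
       (+-congˡ (mul-localʳ W A B i b (λ i′ j i′≤i _ → rows-agree a i′ (ℕₚ.≤-trans i′≤i i≤a) j)))
       (sym (eB (suc i) b)))

  module Composition (X : PS2) (X00 : X 0 0 ≈ 0#) where

    powT-low : ∀ n a b → a +ℕ b < n → powT X n a b ≈ 0#
    powT-low (suc n) a b (s≤s ab≤n) = trans (reflexive (T*≡mul2 X (powT X n) a b))
      (Σ-zero a (λ i i≤a → Σ-zero b (λ j j≤b → term i j i≤a j≤b)))
      where
      term : ∀ i j → i ≤ a → j ≤ b → X i j * powT X n (a ∸ i) (b ∸ j) ≈ 0#
      term zero    zero    _   _   = trans (*-congʳ X00) (zeroˡ _)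
      term zero    (suc j) _   j<b = trans (*-congˡ (powT-low n _ _ (ℕₚ.<-≤-trans
        (ℕₚ.+-mono-≤-< (ℕₚ.m∸n≤m a 0) (ℕₚ.∸-monoʳ-< {b} (s≤s z≤n) j<b)) ab≤n))) (zeroʳ _)
      term (suc i) j       i<a j≤b = trans (*-congˡ (powT-low n _ _ (ℕₚ.<-≤-trans
        (ℕₚ.+-mono-<-≤ (ℕₚ.∸-monoʳ-< {a} (s≤s z≤n) i<a) (ℕₚ.m∸n≤m b j)) ab≤n))) (zeroʳ _)

    compose≈ : ∀ A a b → compose A X a b ≈ sumTo (a +ℕ b) (λ n → A n * powT X n a b)
    compose≈ A a b = Σ-cong (a +ℕ b) (λ n → *-congˡ (pow2≈powT X n a b))

    -- the polynomial truncation Σ_{n ≤ N} A n X^n, an honest element of T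
    compN : PS → ℕ → PS2
    compN A N = TS.sumTo N (λ n → const2 (A n) T.* powT X n)

    compose-truncate : ∀ A N a b → a +ℕ b ≤ N → compose A X a b ≈ compN A N a b
    compose-truncate A N a b ab≤N = begin
        compose A X a b
      ≈⟨ compose≈ A a b ⟩
        sumTo (a +ℕ b) (λ n → A n * powT X n a b)
      ≈⟨ Σ-extend (a +ℕ b) N _ ab≤N (λ n lt → trans (*-congˡ (powT-low n a b lt)) (zeroʳ _)) ⟨
        sumTo N (λ n → A n * powT X n a b)
      ≈⟨ Σ-cong N (λ n → const-mul (A n) (powT X n) a b) ⟨
        sumTo N (λ n → (const2 (A n) T.* powT X n) a b)
      ≈⟨ reflexive (sumTo-coeff₂ N _ a b) ⟨
        compN A N a b ∎

    -- The chain rule δ(A(X)) = A′(X) δX holds for every derivation δ of T that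
    -- kills constants and is local: δP in total degree ≤ N depends only on P
    -- in total degree ≤ N+1 (so that truncations may be differentiated).
    module ChainRule (δ : PS2 → PS2)
      (δ-cong : ∀ {P Q} → P ≈T Q → δ P ≈T δ Q)
      (δ-+ : ∀ P Q → δ (P T.+ Q) ≈T (δ P T.+ δ Q))
      (δ-leibniz : ∀ P Q → δ (P T.* Q) ≈T ((δ P T.* Q) T.+ (P T.* δ Q)))
      (δ-const : ∀ k → δ (const2 k) ≈T T.0#)
      (δ-local : ∀ N P Q → (∀ i j → i +ℕ j ≤ suc N → P i j ≈ Q i j) →
                 ∀ a b → a +ℕ b ≤ N → δ P a b ≈ δ Q a b)
      where

      δ-sum : ∀ n F → δ (TS.sumTo n F) ≈T TS.sumTo n (δ ∘ F)
      δ-sum zero    F = T.refl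
      δ-sum (suc n) F = T.trans (δ-+ _ _) (T.+-cong (δ-sum n F) (T.refl {δ (F (suc n))}))

      δ-1 : δ T.1# ≈T T.0#
      δ-1 = T.trans (δ-cong (T.sym const-1)) (δ-const 1#)

      δ-scale : ∀ k P → δ (const2 k T.* P) ≈T (const2 k T.* δ P)
      δ-scale k P = T.trans (δ-leibniz _ _)
        (T.trans (T.+-cong (T.trans (T.*-cong (δ-const k) (T.refl {P})) (T.zeroˡ P)) (T.refl {const2 k T.* δ P}))
                 (T.+-identityˡ _))

      δ-pow : ∀ n → δ (powT X (suc n)) ≈T (const2 (natR (suc n)) T.* (powT X n T.* δ X))
      δ-pow zero = TR.begin
          δ (X T.* T.1#)
        TR.≈⟨ δ-leibniz _ _ ⟩
          (δ X T.* T.1#) T.+ (X T.* δ T.1#)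
        TR.≈⟨ T.+-cong (T.refl {δ X T.* T.1#}) (T.*-cong (T.refl {X}) δ-1) ⟩
          (δ X T.* T.1#) T.+ (X T.* T.0#)
        TR.≈⟨ solveT 2 (λ d x → ((d ⊗ conT 1) ⊕ (x ⊗ conT 0)) ⊜ (conT 1 ⊗ (conT 1 ⊗ d))) T.refl (δ X) X ⟩
          T.1# T.* (T.1# T.* δ X)
        TR.≈⟨ T.*-cong (T.trans (const-cong (+-identityʳ 1#)) const-1) (T.refl {T.1# T.* δ X}) ⟨
          const2 (natR 1) T.* (T.1# T.* δ X) TR.∎
      δ-pow (suc n) = TR.begin
          δ (X T.* powT X (suc n))
        TR.≈⟨ δ-leibniz _ _ ⟩
          (δ X T.* powT X (suc n)) T.+ (X T.* δ (powT X (suc n)))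
        TR.≈⟨ T.+-cong (T.refl {δ X T.* powT X (suc n)}) (T.*-cong (T.refl {X}) (δ-pow n)) ⟩
          (δ X T.* (X T.* powT X n)) T.+ (X T.* (const2 (natR (suc n)) T.* (powT X n T.* δ X)))
        TR.≈⟨ solveT 4 (λ d x p k → ((d ⊗ (x ⊗ p)) ⊕ (x ⊗ (k ⊗ (p ⊗ d)))) ⊜ ((conT 1 ⊕ k) ⊗ ((x ⊗ p) ⊗ d)))
               T.refl (δ X) X (powT X n) (const2 (natR (suc n))) ⟩
          (T.1# T.+ const2 (natR (suc n))) T.* ((X T.* powT X n) T.* δ X)
        TR.≈⟨ T.*-cong (T.trans (T.+-cong (T.sym const-1) (T.refl {const2 (natR (suc n))}))
                                (T.sym (const-+ 1# (natR (suc n)))))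
                       (T.refl {(X T.* powT X n) T.* δ X}) ⟩
          const2 (natR (suc (suc n))) T.* (powT X (suc n) T.* δ X) TR.∎

      δ-compN : ∀ A N → δ (compN A (suc N)) ≈T (compN (deriv A) N T.* δ X)
      δ-compN A N = TR.begin
          δ (compN A (suc N))
        TR.≈⟨ δ-sum (suc N) _ ⟩
          TS.sumTo (suc N) (λ n → δ (const2 (A n) T.* powT X n))
        TR.≈⟨ TΣ.Σ-shift N _ ⟩
          δ (const2 (A 0) T.* T.1#) T.+ TS.sumTo N (λ n → δ (const2 (A (suc n)) T.* powT X (suc n)))
        TR.≈⟨ T.+-cong constant-term (TΣ.Σ-cong N term) ⟩
          T.0# T.+ TS.sumTo N (λ n → (const2 (deriv A n) T.* powT X n) T.* δ X)
        TR.≈⟨ T.+-identityˡ _ ⟩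
          TS.sumTo N (λ n → (const2 (deriv A n) T.* powT X n) T.* δ X)
        TR.≈⟨ TΣ.Σ-*ʳ N (δ X) _ ⟨
          compN (deriv A) N T.* δ X TR.∎
        where
        constant-term : δ (const2 (A 0) T.* T.1#) ≈T T.0#
        constant-term = T.trans (δ-scale (A 0) T.1#) (T.trans (T.*-cong (T.refl {const2 (A 0)}) δ-1) (T.zeroʳ _))
        term : ∀ n → δ (const2 (A (suc n)) T.* powT X (suc n)) ≈T ((const2 (deriv A n) T.* powT X n) T.* δ X)
        term n = TR.begin
            δ (const2 (A (suc n)) T.* powT X (suc n))
          TR.≈⟨ δ-scale _ _ ⟩
            const2 (A (suc n)) T.* δ (powT X (suc n))
          TR.≈⟨ T.*-cong (T.refl {const2 (A (suc n))}) (δ-pow n) ⟩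
            const2 (A (suc n)) T.* (const2 (natR (suc n)) T.* (powT X n T.* δ X))
          TR.≈⟨ T.*-assoc (const2 (A (suc n))) (const2 (natR (suc n))) (powT X n T.* δ X) ⟨
            (const2 (A (suc n)) T.* const2 (natR (suc n))) T.* (powT X n T.* δ X)
          TR.≈⟨ T.*-cong (T.trans (const-* _ _) (const-cong (*-comm _ _))) (T.refl {powT X n T.* δ X}) ⟩
            const2 (deriv A n) T.* (powT X n T.* δ X)
          TR.≈⟨ T.*-assoc (const2 (deriv A n)) (powT X n) (δ X) ⟨
            (const2 (deriv A n) T.* powT X n) T.* δ X TR.∎

      chain : ∀ A → δ (compose A X) ≈T (compose (deriv A) X T.* δ X)
      chain A a b = begin
          δ (compose A X) a b
        ≈⟨ δ-local (a +ℕ b) (compose A X) (compN A (suc (a +ℕ b)))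
                   (λ i j → compose-truncate A _ i j) a b ℕₚ.≤-refl ⟩
          δ (compN A (suc (a +ℕ b))) a b
        ≈⟨ δ-compN A (a +ℕ b) a b ⟩
          (compN (deriv A) (a +ℕ b) T.* δ X) a b
        ≈⟨ mul-localˡ (compose (deriv A) X) (compN (deriv A) (a +ℕ b)) (δ X) a b
             (λ i j i≤a j≤b → compose-truncate (deriv A) _ i j (ℕₚ.+-mono-≤ i≤a j≤b)) ⟨
          (compose (deriv A) X T.* δ X) a b ∎

    chain-t : ∀ A → Dt (compose A X) ≈T (compose (deriv A) X T.* Dt X)
    chain-t = ChainRule.chain Dt Dt-cong Dt-+ Dt-leibniz Dt-const
      (λ N P Q e a b ab≤N → *-congˡ (e (suc a) b (s≤s ab≤N)))

    chain-y : ∀ A → Dy (compose A X) ≈T (compose (deriv A) X T.* Dy X)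
    chain-y = ChainRule.chain Dy Dy-cong Dy-+ Dy-leibniz Dy-const
      (λ N P Q e a b ab≤N → *-congˡ (e a (suc b) (ℕₚ.≤-trans (ℕₚ.≤-reflexive (ℕₚ.+-suc a b)) (s≤s ab≤N))))

    compose-row0 : ∀ A → (∀ b → X 0 b ≈ xSer b) → ∀ b → compose A X 0 b ≈ A b
    compose-row0 A X-row0 b = trans
      (Σ-cong b (λ n → *-congˡ (trans (pow2≈powT X n 0 b) (trans (powT-row0 X n b) (pow1-cong X-row0 n b)))))
      (subst-x b A)

  Dtⁿ Dyⁿ : ℕ → PS2 → PS2
  Dtⁿ zero    P = P
  Dtⁿ (suc m) P = Dt (Dtⁿ m P)
  Dyⁿ zero    P = P
  Dyⁿ (suc m) P = Dyⁿ m (Dy P)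

  Dyⁿ-cong : ∀ m {P Q} → P ≈T Q → Dyⁿ m P ≈T Dyⁿ m Q
  Dyⁿ-cong zero    e = e
  Dyⁿ-cong (suc m) e = Dyⁿ-cong m (Dy-cong e)

  Dt-Dyⁿ-comm : ∀ m P → Dt (Dyⁿ m P) ≈T Dyⁿ m (Dt P)
  Dt-Dyⁿ-comm zero    P = T.refl
  Dt-Dyⁿ-comm (suc m) P = T.trans (Dt-Dyⁿ-comm m (Dy P)) (Dyⁿ-cong m (Dt-Dy-comm P))

  Dtⁿ-coeff : ∀ m P a b → natR (a !) * Dtⁿ m P a b ≈ natR ((a +ℕ m) !) * P (a +ℕ m) b
  Dtⁿ-coeff zero    P a b = reflexive (Eq.cong (λ z → natR (z !) * P z b) (Eq.sym (ℕₚ.+-identityʳ a)))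
  Dtⁿ-coeff (suc m) P a b = begin
      natR (a !) * (natR (suc a) * Dtⁿ m P (suc a) b)   ≈⟨ *-assoc _ _ _ ⟨
      (natR (a !) * natR (suc a)) * Dtⁿ m P (suc a) b   ≈⟨ *-congʳ (trans (*-comm _ _) (sym (natR-* (suc a) (a !)))) ⟩
      natR (suc a !) * Dtⁿ m P (suc a) b                ≈⟨ Dtⁿ-coeff m P (suc a) b ⟩
      natR ((suc a +ℕ m) !) * P (suc a +ℕ m) b          ≈⟨ reflexive (Eq.cong (λ z → natR (z !) * P z b) (ℕₚ.+-suc a m)) ⟨
      natR ((a +ℕ suc m) !) * P (a +ℕ suc m) b          ∎

  Dyⁿ-coeff : ∀ m P a b → natR (b !) * Dyⁿ m P a b ≈ natR ((b +ℕ m) !) * P a (b +ℕ m)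
  Dyⁿ-coeff zero    P a b = reflexive (Eq.cong (λ z → natR (z !) * P a z) (Eq.sym (ℕₚ.+-identityʳ b)))
  Dyⁿ-coeff (suc m) P a b = begin
      natR (b !) * Dyⁿ m (Dy P) a b
    ≈⟨ Dyⁿ-coeff m (Dy P) a b ⟩
      natR ((b +ℕ m) !) * (natR (suc (b +ℕ m)) * P a (suc (b +ℕ m)))
    ≈⟨ *-assoc _ _ _ ⟨
      (natR ((b +ℕ m) !) * natR (suc (b +ℕ m))) * P a (suc (b +ℕ m))
    ≈⟨ *-congʳ (trans (*-comm _ _) (sym (natR-* (suc (b +ℕ m)) ((b +ℕ m) !)))) ⟩
      natR (suc (b +ℕ m) !) * P a (suc (b +ℕ m))
    ≈⟨ reflexive (Eq.cong (λ z → natR (z !) * P a z) (ℕₚ.+-suc b m)) ⟨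
      natR ((b +ℕ suc m) !) * P a (b +ℕ suc m) ∎

  -- The solution X of X = y + t F(X) satisfies X_t = F(X) X_y, hence every
  -- composite A(X) satisfies the transport equation U_t = F(X) U_y; this
  -- yields the Lagrange–Bürmann formula for the coefficients of A(X).
  module Transport (F : PS) (X : PS2) (X00 : X 0 0 ≈ 0#)
                   (X-fix : X ≈T (ySer T.+ tMul (compose F X))) where
    open Composition X X00
    open import Algebra.Properties.CommutativeSemigroup T.*-commutativeSemigroup using (x∙yz≈y∙xz)

    FX F′X : PS2
    FX  = compose F X
    F′X = compose (deriv F) X

    Dt-X : Dt X ≈T (FX T.+ tMul (F′X T.* Dt X))
    Dt-X = TR.begin
        Dt X                            TR.≈⟨ Dt-cong X-fix ⟩
        Dt (ySer T.+ tMul FX)           TR.≈⟨ Dt-+ ySer (tMul FX) ⟩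
        Dt ySer T.+ Dt (tMul FX)        TR.≈⟨ T.+-cong Dt-y (Dt-tMul FX) ⟩
        T.0# T.+ (FX T.+ tMul (Dt FX))  TR.≈⟨ T.+-identityˡ _ ⟩
        FX T.+ tMul (Dt FX)             TR.≈⟨ T.+-cong (T.refl {FX}) (tMul-cong (chain-t F)) ⟩
        FX T.+ tMul (F′X T.* Dt X)      TR.∎

    Dy-X : Dy X ≈T (T.1# T.+ tMul (F′X T.* Dy X))
    Dy-X = TR.begin
        Dy X                            TR.≈⟨ Dy-cong X-fix ⟩
        Dy (ySer T.+ tMul FX)           TR.≈⟨ Dy-+ ySer (tMul FX) ⟩
        Dy ySer T.+ Dy (tMul FX)        TR.≈⟨ T.+-cong Dy-y (Dy-tMul FX) ⟩
        T.1# T.+ tMul (Dy FX)           TR.≈⟨ T.+-cong (T.refl {T.1#}) (tMul-cong (chain-y F)) ⟩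
        T.1# T.+ tMul (F′X T.* Dy X)    TR.∎

    -- F(X) X_y solves the same equation as X_t, so the two agree
    transport-X : Dt X ≈T (FX T.* Dy X)
    transport-X = fixpoint-unique FX F′X (Dt X) (FX T.* Dy X) Dt-X (TR.begin
        FX T.* Dy X
      TR.≈⟨ T.*-cong (T.refl {FX}) Dy-X ⟩
        FX T.* (T.1# T.+ tMul (F′X T.* Dy X))
      TR.≈⟨ T.distribˡ FX T.1# (tMul (F′X T.* Dy X)) ⟩
        (FX T.* T.1#) T.+ (FX T.* tMul (F′X T.* Dy X))
      TR.≈⟨ T.+-cong (T.*-identityʳ FX) (tMul-mulʳ FX _) ⟩
        FX T.+ tMul (FX T.* (F′X T.* Dy X))
      TR.≈⟨ T.+-cong (T.refl {FX}) (tMul-cong (x∙yz≈y∙xz FX F′X (Dy X))) ⟩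
        FX T.+ tMul (F′X T.* (FX T.* Dy X)) TR.∎)

    Transported : PS2 → Set ℓ
    Transported U = Dt U ≈T (FX T.* Dy U)

    compose-transported : ∀ A → Transported (compose A X)
    compose-transported A = TR.begin
        Dt (compose A X)                          TR.≈⟨ chain-t A ⟩
        compose (deriv A) X T.* Dt X              TR.≈⟨ T.*-cong (T.refl {compose (deriv A) X}) transport-X ⟩
        compose (deriv A) X T.* (FX T.* Dy X)     TR.≈⟨ x∙yz≈y∙xz (compose (deriv A) X) FX (Dy X) ⟩
        FX T.* (compose (deriv A) X T.* Dy X)     TR.≈⟨ T.*-cong (T.refl {FX}) (chain-y A) ⟨
        FX T.* Dy (compose A X)                   TR.∎

    *-transported : ∀ U V → Transported U → Transported V → Transported (U T.* V)
    *-transported U V tU tV = TR.begin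
        Dt (U T.* V)
      TR.≈⟨ Dt-leibniz U V ⟩
        (Dt U T.* V) T.+ (U T.* Dt V)
      TR.≈⟨ T.+-cong (T.*-cong tU (T.refl {V})) (T.*-cong (T.refl {U}) tV) ⟩
        ((FX T.* Dy U) T.* V) T.+ (U T.* (FX T.* Dy V))
      TR.≈⟨ solveT 5 (λ f u v du dv → (((f ⊗ du) ⊗ v) ⊕ (u ⊗ (f ⊗ dv))) ⊜ (f ⊗ ((du ⊗ v) ⊕ (u ⊗ dv))))
              T.refl FX U V (Dy U) (Dy V) ⟩
        FX T.* ((Dy U T.* V) T.+ (U T.* Dy V))
      TR.≈⟨ T.*-cong (T.refl {FX}) (Dy-leibniz U V) ⟨
        FX T.* Dy (U T.* V) TR.∎

    powFX-transported : ∀ m → Transported (powT FX m)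
    powFX-transported zero    = T.trans (Dt-cong (T.sym const-1)) (T.trans (Dt-const 1#) (T.sym
      (T.trans (T.*-cong (T.refl {FX}) (T.trans (Dy-cong (T.sym const-1)) (Dy-const 1#))) (T.zeroʳ FX))))
    powFX-transported (suc m) = *-transported FX (powT FX m) (compose-transported F) (powFX-transported m)

    iterate-Dt : ∀ Φ → Transported Φ → ∀ m → Dtⁿ (suc m) Φ ≈T Dyⁿ m (Dy Φ T.* powT FX (suc m))
    iterate-Dt Φ tΦ zero    = T.trans tΦ (T.trans (T.*-comm FX (Dy Φ))
                                (T.*-cong (T.refl {Dy Φ}) (T.sym (T.*-identityʳ FX))))
    iterate-Dt Φ tΦ (suc m) = T.trans (Dt-cong (iterate-Dt Φ tΦ m))
      (T.trans (Dt-Dyⁿ-comm m _) (Dyⁿ-cong m (step (powT FX (suc m)) (powFX-transported (suc m)))))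
      where
      -- ∂_t (Φ_y V) = ∂_y (Φ_y F(X) V) for transported V, since ∂_t Φ_y = ∂_y (F(X) Φ_y)
      step : ∀ V → Transported V → Dt (Dy Φ T.* V) ≈T Dy (Dy Φ T.* (FX T.* V))
      step V tV = TR.begin
          Dt (Dy Φ T.* V)
        TR.≈⟨ Dt-leibniz (Dy Φ) V ⟩
          (Dt (Dy Φ) T.* V) T.+ (Dy Φ T.* Dt V)
        TR.≈⟨ T.+-cong (T.*-cong (T.trans (Dt-Dy-comm Φ) (T.trans (Dy-cong tΦ) (Dy-leibniz FX (Dy Φ))))
                                 (T.refl {V}))
                       (T.*-cong (T.refl {Dy Φ}) tV) ⟩
          (((Dy FX T.* Dy Φ) T.+ (FX T.* Dy (Dy Φ))) T.* V) T.+ (Dy Φ T.* (FX T.* Dy V))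
        TR.≈⟨ solveT 6 (λ a p f q v w → ((((a ⊗ p) ⊕ (f ⊗ q)) ⊗ v) ⊕ (p ⊗ (f ⊗ w)))
                                       ⊜ ((q ⊗ (f ⊗ v)) ⊕ (p ⊗ ((a ⊗ v) ⊕ (f ⊗ w)))))
                T.refl (Dy FX) (Dy Φ) FX (Dy (Dy Φ)) V (Dy V) ⟩
          (Dy (Dy Φ) T.* (FX T.* V)) T.+ (Dy Φ T.* ((Dy FX T.* V) T.+ (FX T.* Dy V)))
        TR.≈⟨ T.trans (Dy-leibniz (Dy Φ) (FX T.* V))
                      (T.+-cong (T.refl {Dy (Dy Φ) T.* (FX T.* V)}) (T.*-cong (T.refl {Dy Φ}) (Dy-leibniz FX V))) ⟨
          Dy (Dy Φ T.* (FX T.* V)) TR.∎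

    X-row0 : ∀ b → X 0 b ≈ xSer b
    X-row0 b = trans (X-fix 0 b) (trans (+-identityʳ _) (ySer-row0 b))

    compose-X-row0 : ∀ A b → compose A X 0 b ≈ A b
    compose-X-row0 A = compose-row0 A X-row0

    lagrange-bürmann : ∀ A m b → natR (b !) * (natR (suc m !) * compose A X (suc m) b)
                                 ≈ natR ((b +ℕ m) !) * mul1 (deriv A) (pow1 F (suc m)) (b +ℕ m)
    lagrange-bürmann A m b = begin
        natR (b !) * (natR (suc m !) * compose A X (suc m) b)
      ≈⟨ *-congˡ (Dtⁿ-coeff (suc m) (compose A X) 0 b) ⟨
        natR (b !) * (natR 1 * Dtⁿ (suc m) (compose A X) 0 b)
      ≈⟨ *-congˡ (trans (*-congʳ (+-identityʳ _)) (*-identityˡ _)) ⟩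
        natR (b !) * Dtⁿ (suc m) (compose A X) 0 b
      ≈⟨ *-congˡ (iterate-Dt (compose A X) (compose-transported A) m 0 b) ⟩
        natR (b !) * Dyⁿ m (Dy (compose A X) T.* powT FX (suc m)) 0 b
      ≈⟨ Dyⁿ-coeff m _ 0 b ⟩
        natR ((b +ℕ m) !) * mul1 (Dy (compose A X) 0) (powT FX (suc m) 0) (b +ℕ m)
      ≈⟨ *-congˡ (mul1-cong (λ i → *-congˡ (compose-X-row0 A (suc i)))
           (λ i → trans (powT-row0 FX (suc m) i) (pow1-cong (compose-X-row0 F) (suc m) i)) (b +ℕ m)) ⟩
        natR ((b +ℕ m) !) * mul1 (deriv A) (pow1 F (suc m)) (b +ℕ m) ∎

module Coefficients {c ℓ} (R : CommutativeRing c ℓ) where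
  open CommutativeRing R
  open Series R
  open FiniteSums R using (Σ-zero; Σ-cong; Σ-extend; Σ-shift; natR-*)
  open PowerSeries R
  open Bivariate R
  open SetoidReasoning setoid
  open import Algebra.Properties.AbelianGroup +-abelianGroup using (ε⁻¹≈ε; x≈y⇒x∙y⁻¹≈ε; xyx⁻¹≈y; //-rightDividesˡ)
  open import Algebra.Solver.Ring.NaturalCoefficients.Default commutativeSemiring
    using (solve; _:*_; _:=_)

  -- const2 k vanishes away from the origin, leaving differences x - 0
  x-0≈x : ∀ x → x - 0# ≈ x
  x-0≈x x = trans (+-congˡ ε⁻¹≈ε) (+-identityʳ x)

  solve-for : ∀ {A A′ B B′ u v} → A * A′ ≈ 1# → B * B′ ≈ 1# → A * (B * u) ≈ v → u ≈ (v * B′) * A′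
  solve-for {A} {A′} {B} {B′} {u} {v} AA′≈1 BB′≈1 ABu≈v = begin
      u                                ≈⟨ trans (*-cong AA′≈1 (trans (*-congʳ BB′≈1) (*-identityˡ u))) (*-identityˡ u) ⟨
      (A * A′) * ((B * B′) * u)        ≈⟨ regroup A A′ B B′ u ⟩
      ((A * (B * u)) * B′) * A′        ≈⟨ *-congʳ (*-congʳ ABu≈v) ⟩
      (v * B′) * A′                    ∎
    where
    regroup : ∀ A A′ B B′ u → (A * A′) * ((B * B′) * u) ≈ ((A * (B * u)) * B′) * A′
    regroup = solve 5 (λ A A′ B B′ u → ((A :* A′) :* ((B :* B′) :* u)) := (((A :* (B :* u)) :* B′) :* A′)) refl

  module _ (inv : ℕ → Carrier) (inv-spec : ∀ n → natR (suc n) * inv n ≈ 1#)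
           (G Fhat : PS) (X : PS2) (X00 : X 0 0 ≈ 0#)
           (X-eq : ∀ a b → X a b - tMul (compose (xMul Fhat) X) a b ≈ ySer a b)
           (H : PS) (H′≈G : ∀ n → deriv H n ≈ G n) where

    F : PS
    F = xMul Fhat

    X-fix : X ≈T (ySer T.+ tMul (compose F X))
    X-fix a b = trans (sym (//-rightDividesˡ (tMul (compose F X) a b) (X a b))) (+-congʳ (X-eq a b))

    open Composition X X00
    open Transport F X X00 X-fix

    factorial-inverse : ∀ n → natR (n !) * recip inv (n !) ≈ 1#
    factorial-inverse n =
      trans (*-congʳ (reflexive (Eq.cong natR (Eq.sym (ℕₚ.suc-pred (n !) {{n ℕₚ.!≢0}})))))
            (inv-spec (pred (n !)))

    scaled-coefficient : ∀ m d → natR (suc d !) * (natR (m !) * compose H X m (suc d)) ≈ Dtilde G F d m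
    scaled-coefficient zero d = begin
        natR (suc d !) * (natR 1 * compose H X 0 (suc d))
      ≈⟨ *-congˡ (trans (*-congʳ (+-identityʳ _)) (trans (*-identityˡ _) (compose-X-row0 H (suc d)))) ⟩
        natR (suc d !) * H (suc d)
      ≈⟨ *-congʳ (trans (natR-* (suc d) (d !)) (*-comm _ _)) ⟩
        (natR (d !) * natR (suc d)) * H (suc d)
      ≈⟨ trans (*-assoc _ _ _) (*-congˡ (H′≈G d)) ⟩
        natR (d !) * G d
      ≈⟨ *-congˡ (trans (mul1-comm G one1 d) (mul1-oneˡ G d)) ⟨
        natR (d !) * mul1 G one1 d
      ≈⟨ reflexive (Eq.cong (λ z → natR (z !) * mul1 G one1 z) (ℕₚ.+-identityʳ d)) ⟨
        Dtilde G F d 0 ∎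
    scaled-coefficient (suc k) d = begin
        natR (suc d !) * (natR (suc k !) * compose H X (suc k) (suc d))
      ≈⟨ lagrange-bürmann H k (suc d) ⟩
        natR ((suc d +ℕ k) !) * mul1 (deriv H) (pow1 F (suc k)) (suc d +ℕ k)
      ≈⟨ *-congˡ (mul1-cong {g = pow1 F (suc k)} H′≈G (λ _ → refl) (suc d +ℕ k)) ⟩
        natR ((suc d +ℕ k) !) * mul1 G (pow1 F (suc k)) (suc d +ℕ k)
      ≈⟨ reflexive (Eq.cong (λ z → natR (z !) * mul1 G (pow1 F (suc k)) z) (ℕₚ.+-suc d k)) ⟨
        Dtilde G F d (suc k) ∎

    -- the y^0 column of H(X) is the constant H(0): for k ≥ 0 Lagrange–Bürmann
    -- reduces [t^(k+1) y^0] H(X) to [y^k] G F^(k+1), which vanishes as F = x F̂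
    column0 : ∀ m → compose H X m 0 ≈ const2 (H 0) m 0
    column0 zero    = *-identityʳ (H 0)
    column0 (suc k) = trans (solve-for (factorial-inverse 0) (factorial-inverse (suc k))
                                       (trans (lagrange-bürmann H k 0) (trans (*-congˡ low-term) (zeroʳ _))))
                            (trans (*-congʳ (zeroˡ _)) (zeroˡ _))
      where
      low-term : mul1 (deriv H) (pow1 F (suc k)) k ≈ 0#
      low-term = Σ-zero k (λ i _ →
        trans (*-congˡ (xMul-pow-low Fhat (suc k) (k ∸ i) (s≤s (ℕₚ.m∸n≤m k i)))) (zeroʳ _))

    EE≈H∘X : ∀ m d → EEDtildeR inv G F m (suc d) ≈ compose H X m (suc d)
    EE≈H∘X m d = sym (solve-for (factorial-inverse (suc d)) (factorial-inverse m) (scaled-coefficient m d))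

    EE≈H∘X-H0 : ∀ a b → EEDtildeR inv G F a b ≈ compose H X a b - const2 (H 0) a b
    EE≈H∘X-H0 a       zero    = sym (x≈y⇒x∙y⁻¹≈ε (column0 a))
    EE≈H∘X-H0 zero    (suc d) = trans (EE≈H∘X 0 d) (sym (x-0≈x _))
    EE≈H∘X-H0 (suc k) (suc d) = trans (EE≈H∘X (suc k) d) (sym (x-0≈x _))

    H∘X-expansion : ∀ a b → compose H X a b ≈ const2 (H 0) a b + intComp inv G X a b
    H∘X-expansion a b = begin
        compose H X a b
      ≈⟨ compose≈ H a b ⟩
        sumTo N (λ n → H n * powT X n a b)
      ≈⟨ Σ-extend N (suc N) _ (ℕₚ.n≤1+n N) (λ n lt → trans (*-congˡ (powT-low n a b lt)) (zeroʳ _)) ⟨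
        sumTo (suc N) (λ n → H n * powT X n a b)
      ≈⟨ Σ-shift N _ ⟩
        H 0 * powT X 0 a b + sumTo N (λ n → H (suc n) * powT X (suc n) a b)
      ≈⟨ +-cong constant-term (Σ-cong N (λ n → *-cong (H-suc n) (sym (pow2≈powT X (suc n) a b)))) ⟩
        const2 (H 0) a b + intComp inv G X a b ∎
      where
      N = a +ℕ b
      constant-term : H 0 * powT X 0 a b ≈ const2 (H 0) a b
      constant-term = trans (sym (const-mul (H 0) T.1# a b)) (T.*-identityʳ (const2 (H 0)) a b)
      H-suc : ∀ n → H (suc n) ≈ G n * inv n
      H-suc n = begin
          H (suc n)                             ≈⟨ trans (*-congʳ (inv-spec n)) (*-identityˡ _) ⟨
          (natR (suc n) * inv n) * H (suc n)    ≈⟨ trans (*-assoc _ _ _) (trans (*-congˡ (*-comm _ _)) (sym (*-assoc _ _ _))) ⟩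
          deriv H n * inv n                      ≈⟨ *-congʳ (H′≈G n) ⟩
          G n * inv n                            ∎

    EE≈intComp : ∀ a b → EEDtildeR inv G F a b ≈ intComp inv G X a b
    EE≈intComp a b = trans (EE≈H∘X-H0 a b) (trans (+-congʳ (H∘X-expansion a b)) (xyx⁻¹≈y _ _))

corollary3 : ∀ {c ℓ} (R : CommutativeRing c ℓ) →
  let open CommutativeRing R
      open Series R
  in (inv : ℕ → Carrier) → (∀ n → natR (suc n) * inv n ≈ 1#) →
     (G Fhat : PS) → G 0 ≈ 1# → ¬ (Fhat 0 ≈ 0#) →
     (X : PS2) → X 0 0 ≈ 0# →
     (∀ a b → X a b - tMul (compose (xMul Fhat) X) a b ≈ ySer a b) →
     (H : PS) → (∀ n → natR (suc n) * H (suc n) ≈ G n) →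
     (∀ a b → EEDtildeR inv G (xMul Fhat) a b ≈ compose H X a b - const2 (H 0) a b)
     × (∀ a b → EEDtildeR inv G (xMul Fhat) a b ≈ intComp inv G X a b)
corollary3 R inv inv-spec G Fhat _ _ X X00 X-eq H H′≈G =
  EE≈H∘X-H0 inv inv-spec G Fhat X X00 X-eq H H′≈G , EE≈intComp inv inv-spec G Fhat X X00 X-eq H H′≈G
  where open Coefficients R
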